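{- Let $G_1$ and $G_2$ be vertex-disjoint $(3,1)$-colorable $4$-regular graphs, and suppose $G_2$ has a loop $vv$ at a vertex $v$. Let $uw$ be an edge of $G_1$. Construct $G$ with $V(G)=V(G_1)\cup V(G_2)$ and $E(G)=(E(G_1)\setminus\{uw\})\cup(E(G_2)\setminus\{vv\})\cup\{uv,wv\}$ (i.e., subdivide $uw$, identify the subdivision vertex with $v$, and delete the loop $vv$). Then $G$ is $(3,1)$-colorable.
   Context: All graphs are finite, undirected pseudographs (multiple edges and loops allowed; a loop contributes $2$ to the degree). A $(3,1)$-coloring of a $4$-regular graph is an edge-coloring using at least two colors such that every vertex is incident to exactly $3$ edges of one color and exactly $1$ edge of a different color. -}

module Defs where

open import Data.Nat using (ℕ; _+_; _≟_)
open import Data.Fin using (Fin; _↑ˡ_; _↑ʳ_)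
import Data.Fin as F
open import Data.Nat.ListAction using (sum)
open import Data.List using (List; []; _∷_; _++_; map; length; lookup; tabulate; removeAt)
open import Data.Product using (_×_; _,_; ∃; ∃-syntax; Σ-syntax)
open import Data.Bool using (if_then_else_)
open import Relation.Nullary using (¬_)
open import Relation.Nullary.Decidable using (⌊_⌋)
open import Relation.Binary.PropositionalEquality using (_≡_; _≢_)

-- A finite pseudograph on vertex set Fin n: a list of edges, each an
-- (unordered) pair of endpoints.  Multiple edges are repeated entries;
-- a loop at v is the pair (v , v).
record Graph : Set where
  constructor graph
  field
    n     : ℕ
    edges : List (Fin n × Fin n)
open Graph public

-- Number of ends of the edge e at vertex v (a loop at v counts 2).
endsAt : ∀ {n} → Fin n → Fin n × Fin n → ℕ
endsAt v (a , b) = (if ⌊ a F.≟ v ⌋ then 1 else 0) + (if ⌊ b F.≟ v ⌋ then 1 else 0)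

degree : (G : Graph) → Fin (n G) → ℕ
degree G v = sum (map (endsAt v) (edges G))

FourRegular : Graph → Set
FourRegular G = ∀ v → degree G v ≡ 4

EdgeColoring : Graph → Set
EdgeColoring G = Fin (length (edges G)) → ℕ

colorDegree : (G : Graph) → EdgeColoring G → Fin (n G) → ℕ → ℕ
colorDegree G c v k =
  sum (tabulate {n = length (edges G)}
         (λ i → if ⌊ c i ≟ k ⌋ then endsAt v (lookup (edges G) i) else 0))

Is31Coloring : (G : Graph) → EdgeColoring G → Set
Is31Coloring G c =
  (∃[ i ] ∃[ j ] c i ≢ c j) ×
  (∀ v → ∃[ a ] ∃[ b ] (a ≢ b × colorDegree G c v a ≡ 3 × colorDegree G c v b ≡ 1))

Colorable31 : Graph → Set
Colorable31 G = ∃[ c ] Is31Coloring G c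

-- The construction: disjoint union of G₁ and G₂ (vertices of G₁ first),
-- removing edge number k of G₁ (the edge uw) and edge number l of G₂
-- (the loop vv), and adding edges uv and wv.
glue : (G₁ G₂ : Graph) → Fin (length (edges G₁)) → Fin (length (edges G₂)) →
       Fin (n G₂) → Graph
glue (graph n₁ E₁) (graph n₂ E₂) k l v =
  graph (n₁ + n₂)
    (map (λ { (a , b) → (a ↑ˡ n₂ , b ↑ˡ n₂) }) (removeAt E₁ k)
     ++ map (λ { (a , b) → (n₁ ↑ʳ a , n₁ ↑ʳ b) }) (removeAt E₂ l)
     ++ ((u ↑ˡ n₂ , n₁ ↑ʳ v) ∷ (w ↑ˡ n₂ , n₁ ↑ʳ v) ∷ []))
  where
    u = Data.Product.proj₁ (lookup E₁ k)
    w = Data.Product.proj₂ (lookup E₁ k)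

-- Keep the coloring of G₁ and give the two new edges uv, wv the color γ of
-- the deleted edge uw, so every vertex of G₁ sees exactly its old color
-- degrees.  Recolor G₂ by the transposition σ exchanging γ with the color λ
-- of the loop vv: then v receives two ends of color γ = σ λ in place of the
-- two ends of the loop, and every vertex of G₂ sees its old color degrees
-- permuted by σ.  A permutation of colors preserves the (3,1) condition.
module Submission where

open import Defs
open import Data.Bool using (true; false; if_then_else_)
open import Data.Empty using (⊥-elim)
open import Data.Fin as Fin using (Fin; zero; suc; _↑ˡ_; _↑ʳ_; splitAt; join)
open import Data.Fin.Properties using (↑ˡ-injective; ↑ʳ-injective; splitAt-↑ˡ; splitAt-↑ʳ; join-splitAt)
open import Data.List using (List; []; _∷_; _++_; map; length; lookup; removeAt)
open import Data.List.Properties using (map-++; map-∘)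
open import Data.Nat using (ℕ; _+_; _≟_)
open import Data.Nat.ListAction using (sum)
open import Data.Nat.ListAction.Properties using (sum-++)
open import Data.Nat.Properties using (+-assoc; +-comm; +-identityʳ; 1+n≢0; +-commutativeSemigroup)
open import Algebra.Properties.CommutativeSemigroup +-commutativeSemigroup using (interchange)
open import Data.Product using (_×_; _,_; proj₁; proj₂; Σ-syntax; ∃-syntax)
open import Data.Sum using (_⊎_; inj₁; inj₂)
open import Function using (id; _∘_)
open import Function.Definitions using (Injective)
open import Relation.Nullary using (Dec; yes; no; ¬_)
open import Relation.Nullary.Decidable using (⌊_⌋)
open import Relation.Binary.PropositionalEquality
open import Algebra.Definitions {A = ℕ} _≡_ using (Involutive)

private
  variable
    A : Set
    m m′ : ℕ

isYes-⇔ : {P Q : Set} → (P → Q) → (Q → P) → (p? : Dec P) (q? : Dec Q) → ⌊ p? ⌋ ≡ ⌊ q? ⌋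
isYes-⇔ P→Q Q→P (yes _) (yes _) = refl
isYes-⇔ P→Q Q→P (no _)  (no _)  = refl
isYes-⇔ P→Q Q→P (yes p) (no ¬q) = ⊥-elim (¬q (P→Q p))
isYes-⇔ P→Q Q→P (no ¬p) (yes q) = ⊥-elim (¬p (Q→P q))

isYes-¬ : {P : Set} → ¬ P → (p? : Dec P) → ⌊ p? ⌋ ≡ false
isYes-¬ ¬p (yes p) = ⊥-elim (¬p p)
isYes-¬ ¬p (no _)  = refl

colorEdges : (E : List A) → (Fin (length E) → ℕ) → List (ℕ × A)
colorEdges []      c = []
colorEdges (e ∷ E) c = (c zero , e) ∷ colorEdges E (c ∘ suc)

-- removeAt (colorEdges E c) k, indexed by the positions of E to avoid a cast
colorEdgesWithout : (E : List A) → (Fin (length E) → ℕ) → Fin (length E) → List (ℕ × A)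
colorEdgesWithout (e ∷ E) c zero    = colorEdges E (c ∘ suc)
colorEdgesWithout (e ∷ E) c (suc k) = (c zero , e) ∷ colorEdgesWithout E (c ∘ suc) k

map-proj₂-colorEdges : ∀ (E : List A) c → map proj₂ (colorEdges E c) ≡ E
map-proj₂-colorEdges []      c = refl
map-proj₂-colorEdges (e ∷ E) c = cong (e ∷_) (map-proj₂-colorEdges E (c ∘ suc))

map-proj₂-colorEdgesWithout : ∀ (E : List A) c k → map proj₂ (colorEdgesWithout E c k) ≡ removeAt E k
map-proj₂-colorEdgesWithout (e ∷ E) c zero    = map-proj₂-colorEdges E (c ∘ suc)
map-proj₂-colorEdgesWithout (e ∷ E) c (suc k) = cong (e ∷_) (map-proj₂-colorEdgesWithout E (c ∘ suc) k)

sum-colorEdgesWithout : ∀ (g : ℕ × A → ℕ) (E : List A) c k →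
  sum (map g (colorEdgesWithout E c k)) + g (c k , lookup E k) ≡ sum (map g (colorEdges E c))
sum-colorEdgesWithout g (e ∷ E) c zero    = +-comm (sum (map g (colorEdges E (c ∘ suc)))) _
sum-colorEdgesWithout g (e ∷ E) c (suc k) =
  trans (+-assoc (g (c zero , e)) _ _) (cong (g (c zero , e) +_) (sum-colorEdgesWithout g E (c ∘ suc) k))

colorOf : (L : List (ℕ × A)) → Fin (length (map proj₂ L)) → ℕ
colorOf (p ∷ L) zero    = proj₁ p
colorOf (p ∷ L) (suc i) = colorOf L i

colorEdges-colorOf : (L : List (ℕ × A)) → colorEdges (map proj₂ L) (colorOf L) ≡ L
colorEdges-colorOf []      = refl
colorEdges-colorOf (p ∷ L) = cong (p ∷_) (colorEdges-colorOf L)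

Edge : ℕ → Set
Edge m = Fin m × Fin m

ColoredEdge : ℕ → Set
ColoredEdge m = ℕ × Edge m

endsOfColorAt : ℕ → Fin m → ColoredEdge m → ℕ
endsOfColorAt k x (c , e) = if ⌊ c ≟ k ⌋ then endsAt x e else 0

colorDegreeIn : List (ColoredEdge m) → Fin m → ℕ → ℕ
colorDegreeIn L x k = sum (map (endsOfColorAt k x) L)

colorDegreeIn-++ : ∀ (L L′ : List (ColoredEdge m)) x k →
  colorDegreeIn (L ++ L′) x k ≡ colorDegreeIn L x k + colorDegreeIn L′ x k
colorDegreeIn-++ L L′ x k = trans (cong sum (map-++ (endsOfColorAt k x) L L′)) (sum-++ (map _ L) _)

colorDegreeIn-map : ∀ (h : ℕ × A → ColoredEdge m) (L : List (ℕ × A)) x k →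
  colorDegreeIn (map h L) x k ≡ sum (map (endsOfColorAt k x ∘ h) L)
colorDegreeIn-map h L x k = cong sum (sym (map-∘ L))

colorDegreeIn-map-colorEdgesWithout : ∀ (h : ℕ × A → ColoredEdge m) (E : List A) c k x y →
  colorDegreeIn (map h (colorEdgesWithout E c k)) x y + endsOfColorAt y x (h (c k , lookup E k)) ≡
  colorDegreeIn (map h (colorEdges E c)) x y
colorDegreeIn-map-colorEdgesWithout h E c k x y =
  trans (cong (_+ endsOfColorAt y x (h (c k , lookup E k))) (colorDegreeIn-map h (colorEdgesWithout E c k) x y))
        (trans (sum-colorEdgesWithout (endsOfColorAt y x ∘ h) E c k) (sym (colorDegreeIn-map h (colorEdges E c) x y)))

colorDegree≡colorDegreeIn : ∀ (E : List (Edge m)) c x k →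
  colorDegree (graph m E) c x k ≡ colorDegreeIn (colorEdges E c) x k
colorDegree≡colorDegreeIn []      c x k = refl
colorDegree≡colorDegreeIn (e ∷ E) c x k =
  cong (endsOfColorAt k x (c zero , e) +_) (colorDegree≡colorDegreeIn E (c ∘ suc) x k)

colorDegree-occurs : ∀ (E : List (Edge m)) c x k → colorDegree (graph m E) c x k ≢ 0 → ∃[ i ] c i ≡ k
colorDegree-occurs []      c x k deg≢0 = ⊥-elim (deg≢0 refl)
colorDegree-occurs (e ∷ E) c x k deg≢0 with c zero ≟ k
... | yes c₀≡k = zero , c₀≡k
... | no _     = let i , cᵢ≡k = colorDegree-occurs E (c ∘ suc) x k deg≢0 in suc i , cᵢ≡k

coloringOf : (L : List (ColoredEdge m)) {E : List (Edge m)} → map proj₂ L ≡ E →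
  Σ[ c ∈ EdgeColoring (graph m E) ] (∀ x k → colorDegree (graph m E) c x k ≡ colorDegreeIn L x k)
coloringOf L refl = colorOf L , λ x k →
  trans (colorDegree≡colorDegreeIn (map proj₂ L) (colorOf L) x k) (cong (λ L′ → colorDegreeIn L′ x k) (colorEdges-colorOf L))

mapEdge : (Fin m → Fin m′) → Edge m → Edge m′
mapEdge f (a , b) = f a , f b

relabel : (Fin m → Fin m′) → (ℕ → ℕ) → ColoredEdge m → ColoredEdge m′
relabel f σ (c , e) = σ c , mapEdge f e

map-proj₂-relabel : ∀ (f : Fin m → Fin m′) σ (L : List (ColoredEdge m)) →
  map proj₂ (map (relabel f σ) L) ≡ map (mapEdge f) (map proj₂ L)
map-proj₂-relabel f σ []      = refl
map-proj₂-relabel f σ (p ∷ L) = cong (_ ∷_) (map-proj₂-relabel f σ L)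

endsAt-injective : {f : Fin m → Fin m′} → Injective _≡_ _≡_ f → ∀ x e → endsAt (f x) (mapEdge f e) ≡ endsAt x e
endsAt-injective {f = f} f-inj x (a , b)
  rewrite isYes-⇔ f-inj (cong f) (f a Fin.≟ f x) (a Fin.≟ x)
        | isYes-⇔ f-inj (cong f) (f b Fin.≟ f x) (b Fin.≟ x) = refl

endsAt-outside : {f : Fin m → Fin m′} {x : Fin m′} → (∀ a → f a ≢ x) → ∀ e → endsAt x (mapEdge f e) ≡ 0
endsAt-outside {f = f} {x} x∉f (a , b)
  rewrite isYes-¬ (x∉f a) (f a Fin.≟ x) | isYes-¬ (x∉f b) (f b Fin.≟ x) = refl

endsOfColorAt-relabel : {f : Fin m → Fin m′} {σ : ℕ → ℕ} → Injective _≡_ _≡_ f → Involutive σ →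
  ∀ k x p → endsOfColorAt k (f x) (relabel f σ p) ≡ endsOfColorAt (σ k) x p
endsOfColorAt-relabel {σ = σ} f-inj σ-inv k x (c , e)
  rewrite isYes-⇔ (λ σc≡k → trans (sym (σ-inv c)) (cong σ σc≡k)) (λ c≡σk → trans (cong σ c≡σk) (σ-inv k))
                  (σ c ≟ k) (c ≟ σ k)
        | endsAt-injective f-inj x e = refl

endsOfColorAt-outside : {f : Fin m → Fin m′} {x : Fin m′} → (∀ a → f a ≢ x) →
  ∀ σ k p → endsOfColorAt k x (relabel f σ p) ≡ 0
endsOfColorAt-outside x∉f σ k (c , e) rewrite endsAt-outside x∉f e with ⌊ σ c ≟ k ⌋
... | true  = refl
... | false = refl

colorDegreeIn-relabel : {f : Fin m → Fin m′} {σ : ℕ → ℕ} → Injective _≡_ _≡_ f → Involutive σ →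
  ∀ L x k → colorDegreeIn (map (relabel f σ) L) (f x) k ≡ colorDegreeIn L x (σ k)
colorDegreeIn-relabel f-inj σ-inv []      x k = refl
colorDegreeIn-relabel f-inj σ-inv (p ∷ L) x k =
  cong₂ _+_ (endsOfColorAt-relabel f-inj σ-inv k x p) (colorDegreeIn-relabel f-inj σ-inv L x k)

colorDegreeIn-outside : {f : Fin m → Fin m′} {x : Fin m′} → (∀ a → f a ≢ x) →
  ∀ σ L k → colorDegreeIn (map (relabel f σ) L) x k ≡ 0
colorDegreeIn-outside x∉f σ []      k = refl
colorDegreeIn-outside x∉f σ (p ∷ L) k =
  cong₂ _+_ (endsOfColorAt-outside x∉f σ k p) (colorDegreeIn-outside x∉f σ L k)

endsOfColorAt-subdivide : ∀ k x c (a b z : Fin m) →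
  endsOfColorAt k x (c , (a , z)) + endsOfColorAt k x (c , (b , z)) ≡
  endsOfColorAt k x (c , (a , b)) + endsOfColorAt k x (c , (z , z))
endsOfColorAt-subdivide k x c a b z with c ≟ k
... | yes _ = interchange (endAt a) (endAt z) (endAt b) (endAt z)
  where endAt : Fin _ → ℕ
        endAt y = if ⌊ y Fin.≟ x ⌋ then 1 else 0
... | no _  = refl

transpose : ℕ → ℕ → ℕ → ℕ
transpose p q x = if ⌊ x ≟ p ⌋ then q else if ⌊ x ≟ q ⌋ then p else x

transpose-left : ∀ p q → transpose p q p ≡ q
transpose-left p q rewrite isYes-⇔ id id (p ≟ p) (yes refl) = refl

transpose-right : ∀ p q → transpose p q q ≡ p
transpose-right p q with q ≟ p
... | yes q≡p = q≡p
... | no _ rewrite isYes-⇔ id id (q ≟ q) (yes refl) = refl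

transpose-other : ∀ {p q x} → x ≢ p → x ≢ q → transpose p q x ≡ x
transpose-other {p} {q} {x} x≢p x≢q rewrite isYes-¬ x≢p (x ≟ p) | isYes-¬ x≢q (x ≟ q) = refl

transpose-involutive : ∀ p q → Involutive (transpose p q)
transpose-involutive p q x = by-cases (x ≟ p) (x ≟ q)
  where
    by-cases : Dec (x ≡ p) → Dec (x ≡ q) → transpose p q (transpose p q x) ≡ x
    by-cases (yes x≡p) _ rewrite x≡p | transpose-left p q = transpose-right p q
    by-cases (no _) (yes x≡q) rewrite x≡q | transpose-right p q = transpose-left p q
    by-cases (no x≢p) (no x≢q) rewrite transpose-other x≢p x≢q = transpose-other x≢p x≢q

↑ˡ≢↑ʳ : ∀ (a : Fin m) (b : Fin m′) → a ↑ˡ m′ ≢ m ↑ʳ b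
↑ˡ≢↑ʳ {m} {m′} a b eq with trans (sym (splitAt-↑ˡ m a m′)) (trans (cong (splitAt m) eq) (splitAt-↑ʳ m m′ b))
... | ()

↑-elim : ∀ (P : Fin (m + m′) → Set) → (∀ a → P (a ↑ˡ m′)) → (∀ b → P (m ↑ʳ b)) → ∀ x → P x
↑-elim {m} {m′} P left right x = subst P (join-splitAt m m′ x) (from (splitAt m x))
  where
    from : (s : Fin m ⊎ Fin m′) → P (join m m′ s)
    from (inj₁ a) = left a
    from (inj₂ b) = right b

Is31At : (G : Graph) → EdgeColoring G → Fin (n G) → Set
Is31At G c x = ∃[ a ] ∃[ b ] (a ≢ b × colorDegree G c x a ≡ 3 × colorDegree G c x b ≡ 1)

Is31At-permute : ∀ {G G′ : Graph} {c c′ x x′} {σ : ℕ → ℕ} → Involutive σ →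
  (∀ y → colorDegree G′ c′ x′ y ≡ colorDegree G c x (σ y)) → Is31At G c x → Is31At G′ c′ x′
Is31At-permute {G} {c = c} {x = x} {σ = σ} σ-inv deg (a , b , a≢b , deg-a , deg-b) =
  σ a , σ b , (λ σa≡σb → a≢b (trans (sym (σ-inv a)) (trans (cong σ σa≡σb) (σ-inv b)))) ,
  trans (deg (σ a)) (trans (cong (colorDegree G c x) (σ-inv a)) deg-a) ,
  trans (deg (σ b)) (trans (cong (colorDegree G c x) (σ-inv b)) deg-b)

Is31At⇒twoColors : ∀ (E : List (Edge m)) c x → Is31At (graph m E) c x → ∃[ i ] ∃[ j ] c i ≢ c j
Is31At⇒twoColors E c x (a , b , a≢b , deg-a , deg-b) =
  let i , cᵢ≡a = colorDegree-occurs E c x a (λ deg≡0 → 1+n≢0 (trans (sym deg-a) deg≡0))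
      j , cⱼ≡b = colorDegree-occurs E c x b (λ deg≡0 → 1+n≢0 (trans (sym deg-b) deg≡0))
  in i , j , λ cᵢ≡cⱼ → a≢b (trans (sym cᵢ≡a) (trans cᵢ≡cⱼ cⱼ≡b))

module Gluing {n₁ n₂} (E₁ : List (Edge n₁)) (E₂ : List (Edge n₂))
              (c₁ : Fin (length E₁) → ℕ) (c₂ : Fin (length E₂) → ℕ)
              (k : Fin (length E₁)) (l : Fin (length E₂)) (v : Fin n₂) where

  γ : ℕ
  γ = c₁ k

  σ : ℕ → ℕ
  σ = transpose (c₂ l) γ

  left : ColoredEdge n₁ → ColoredEdge (n₁ + n₂)
  left = relabel (_↑ˡ n₂) id

  right : ColoredEdge n₂ → ColoredEdge (n₁ + n₂)
  right = relabel (n₁ ↑ʳ_) σ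

  subdivision : List (ColoredEdge (n₁ + n₂))
  subdivision = (γ , (proj₁ (lookup E₁ k) ↑ˡ n₂ , n₁ ↑ʳ v)) ∷ (γ , (proj₂ (lookup E₁ k) ↑ˡ n₂ , n₁ ↑ʳ v)) ∷ []

  glued : List (ColoredEdge (n₁ + n₂))
  glued = map left (colorEdgesWithout E₁ c₁ k) ++ map right (colorEdgesWithout E₂ c₂ l) ++ subdivision

  map-proj₂-glued : map proj₂ glued ≡ edges (glue (graph n₁ E₁) (graph n₂ E₂) k l v)
  map-proj₂-glued = begin
    map proj₂ glued
      ≡⟨ map-++ proj₂ (map left W₁) _ ⟩
    map proj₂ (map left W₁) ++ map proj₂ (map right W₂ ++ subdivision)
      ≡⟨ cong (map proj₂ (map left W₁) ++_) (map-++ proj₂ (map right W₂) subdivision) ⟩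
    map proj₂ (map left W₁) ++ map proj₂ (map right W₂) ++ map proj₂ subdivision
      ≡⟨ cong₂ (λ X Y → X ++ Y ++ map proj₂ subdivision) (relabelled-edges (_↑ˡ n₂) id E₁ c₁ k)
                                                        (relabelled-edges (n₁ ↑ʳ_) σ E₂ c₂ l) ⟩
    edges (glue (graph n₁ E₁) (graph n₂ E₂) k l v) ∎
    where
      open ≡-Reasoning
      W₁ = colorEdgesWithout E₁ c₁ k
      W₂ = colorEdgesWithout E₂ c₂ l
      relabelled-edges : ∀ {m m′} (f : Fin m → Fin m′) τ E c k →
        map proj₂ (map (relabel f τ) (colorEdgesWithout E c k)) ≡ map (mapEdge f) (removeAt E k)
      relabelled-edges f τ E c k =
        trans (map-proj₂-relabel f τ (colorEdgesWithout E c k)) (cong (map (mapEdge f)) (map-proj₂-colorEdgesWithout E c k))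

  module _ (loop : lookup E₂ l ≡ (v , v)) where

    -- The two subdivision edges have the ends at u, w of the deleted edge
    -- uw, and at v the two ends of the deleted loop, whose color σ maps to γ.
    colorDegreeIn-subdivision : ∀ x y →
      colorDegreeIn subdivision x y ≡
      endsOfColorAt y x (left (c₁ k , lookup E₁ k)) + endsOfColorAt y x (right (c₂ l , lookup E₂ l))
    colorDegreeIn-subdivision x y =
      trans (cong (endsOfColorAt y x (γ , (u ↑ˡ n₂ , v′)) +_) (+-identityʳ _))
        (trans (endsOfColorAt-subdivide y x γ (u ↑ˡ n₂) (w ↑ˡ n₂) v′)
               (cong (endsOfColorAt y x (left (c₁ k , lookup E₁ k)) +_) (sym loop-ends)))
      where
        u = proj₁ (lookup E₁ k)
        w = proj₂ (lookup E₁ k)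
        v′ = n₁ ↑ʳ v
        loop-ends : endsOfColorAt y x (right (c₂ l , lookup E₂ l)) ≡ endsOfColorAt y x (γ , (v′ , v′))
        loop-ends = trans (cong (λ e → endsOfColorAt y x (right (c₂ l , e))) loop)
                          (cong (λ c → endsOfColorAt y x (c , (v′ , v′))) (transpose-left (c₂ l) γ))

    colorDegreeIn-glued : ∀ x y →
      colorDegreeIn glued x y ≡
      colorDegreeIn (map left (colorEdges E₁ c₁)) x y + colorDegreeIn (map right (colorEdges E₂ c₂)) x y
    colorDegreeIn-glued x y = begin
      D glued
        ≡⟨ colorDegreeIn-++ (map left W₁) _ x y ⟩
      D (map left W₁) + D (map right W₂ ++ subdivision)
        ≡⟨ cong (D (map left W₁) +_) (colorDegreeIn-++ (map right W₂) subdivision x y) ⟩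
      D (map left W₁) + (D (map right W₂) + D subdivision)
        ≡⟨ cong (λ t → D (map left W₁) + (D (map right W₂) + t)) (colorDegreeIn-subdivision x y) ⟩
      D (map left W₁) + (D (map right W₂) + (ends (left e₁) + ends (right e₂)))
        ≡⟨ sym (+-assoc (D (map left W₁)) _ _) ⟩
      (D (map left W₁) + D (map right W₂)) + (ends (left e₁) + ends (right e₂))
        ≡⟨ interchange (D (map left W₁)) _ _ _ ⟩
      (D (map left W₁) + ends (left e₁)) + (D (map right W₂) + ends (right e₂))
        ≡⟨ cong₂ _+_ (colorDegreeIn-map-colorEdgesWithout left E₁ c₁ k x y)
                     (colorDegreeIn-map-colorEdgesWithout right E₂ c₂ l x y) ⟩
      D (map left (colorEdges E₁ c₁)) + D (map right (colorEdges E₂ c₂)) ∎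
      where
        open ≡-Reasoning
        D : List (ColoredEdge (n₁ + n₂)) → ℕ
        D L = colorDegreeIn L x y
        ends : ColoredEdge (n₁ + n₂) → ℕ
        ends = endsOfColorAt y x
        W₁ = colorEdgesWithout E₁ c₁ k
        W₂ = colorEdgesWithout E₂ c₂ l
        e₁ = (c₁ k , lookup E₁ k)
        e₂ = (c₂ l , lookup E₂ l)

    colorDegreeIn-glued-↑ˡ : ∀ a y → colorDegreeIn glued (a ↑ˡ n₂) y ≡ colorDegree (graph n₁ E₁) c₁ a y
    colorDegreeIn-glued-↑ˡ a y = begin
      colorDegreeIn glued (a ↑ˡ n₂) y
        ≡⟨ colorDegreeIn-glued (a ↑ˡ n₂) y ⟩
      colorDegreeIn (map left (colorEdges E₁ c₁)) (a ↑ˡ n₂) y + colorDegreeIn (map right (colorEdges E₂ c₂)) (a ↑ˡ n₂) y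
        ≡⟨ cong₂ _+_ (colorDegreeIn-relabel (λ {i} {j} → ↑ˡ-injective n₂ i j) (λ _ → refl) (colorEdges E₁ c₁) a y)
                     (colorDegreeIn-outside (λ b eq → ↑ˡ≢↑ʳ a b (sym eq)) σ (colorEdges E₂ c₂) y) ⟩
      colorDegreeIn (colorEdges E₁ c₁) a y + 0
        ≡⟨ +-identityʳ _ ⟩
      colorDegreeIn (colorEdges E₁ c₁) a y
        ≡⟨ sym (colorDegree≡colorDegreeIn E₁ c₁ a y) ⟩
      colorDegree (graph n₁ E₁) c₁ a y ∎
      where open ≡-Reasoning

    colorDegreeIn-glued-↑ʳ : ∀ b y → colorDegreeIn glued (n₁ ↑ʳ b) y ≡ colorDegree (graph n₂ E₂) c₂ b (σ y)
    colorDegreeIn-glued-↑ʳ b y = begin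
      colorDegreeIn glued (n₁ ↑ʳ b) y
        ≡⟨ colorDegreeIn-glued (n₁ ↑ʳ b) y ⟩
      colorDegreeIn (map left (colorEdges E₁ c₁)) (n₁ ↑ʳ b) y + colorDegreeIn (map right (colorEdges E₂ c₂)) (n₁ ↑ʳ b) y
        ≡⟨ cong₂ _+_ (colorDegreeIn-outside (λ a → ↑ˡ≢↑ʳ a b) id (colorEdges E₁ c₁) y)
                     (colorDegreeIn-relabel (λ {i} {j} → ↑ʳ-injective n₁ i j) (transpose-involutive (c₂ l) γ) (colorEdges E₂ c₂) b y) ⟩
      colorDegreeIn (colorEdges E₂ c₂) b (σ y)
        ≡⟨ sym (colorDegree≡colorDegreeIn E₂ c₂ b (σ y)) ⟩
      colorDegree (graph n₂ E₂) c₂ b (σ y) ∎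
      where open ≡-Reasoning

lemma4 : (G₁ G₂ : Graph) → FourRegular G₁ → FourRegular G₂ →
         Colorable31 G₁ → Colorable31 G₂ →
         (v : Fin (n G₂)) (l : Fin (length (edges G₂))) →
         lookup (edges G₂) l ≡ (v , v) →
         (k : Fin (length (edges G₁))) →
         Colorable31 (glue G₁ G₂ k l v)
lemma4 (graph n₁ E₁) (graph n₂ E₂) _ _ (c₁ , _ , is31₁) (c₂ , _ , is31₂) v l loop k =
  c , Is31At⇒twoColors (edges G) c (n₁ ↑ʳ v) (is31 (n₁ ↑ʳ v)) , is31
  where
    open Gluing E₁ E₂ c₁ c₂ k l v
    G = glue (graph n₁ E₁) (graph n₂ E₂) k l v
    coloring = coloringOf glued map-proj₂-glued
    c = proj₁ coloring
    is31 : ∀ x → Is31At G c x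
    is31 = ↑-elim (Is31At G c)
      (λ a → Is31At-permute {graph n₁ E₁} {G} {c₁} {c} {a} (λ _ → refl) (λ y → trans (proj₂ coloring _ y) (colorDegreeIn-glued-↑ˡ loop a y)) (is31₁ a))
      (λ b → Is31At-permute {graph n₂ E₂} {G} {c₂} {c} {b} (transpose-involutive (c₂ l) γ)
                            (λ y → trans (proj₂ coloring _ y) (colorDegreeIn-glued-↑ʳ loop b y)) (is31₂ b))
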